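{- Let $G$ be a finite simple graph with $\alpha(G)=2$, let $uv$ be a dominating edge of $G$, and let $W$ be the set of vertices of $G$ adjacent to both $u$ and $v$. If $|W|\geq 4$ and the induced subgraph $G[W]$ is not a $5$-cycle, then there exist cliques $C^1,\dots,C^\ell$ of $G[W]$ with $C^1\cup\dots\cup C^\ell=W$ and $\ell\leq \lceil \frac{|W|}{2}\rceil$.
   Context: $\alpha(G)$ is the independence number. An edge $uv$ is dominating if every vertex of $G$ other than $u,v$ is adjacent to at least one of $u,v$. A clique is a set of pairwise adjacent vertices. -}

module Defs where

open import Data.Nat using (ℕ; suc; _+_; _≤_; ⌈_/2⌉)
open import Data.Nat.DivMod using (_%_)
open import Data.Fin using (Fin; toℕ)
open import Data.Fin.Subset using (Subset; _∈_; _⊆_; ∣_∣)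
open import Data.Bool using (Bool; true; false; _∧_)
open import Data.Vec using (tabulate)
open import Data.Product using (Σ; ∃; _×_)
open import Data.Sum using (_⊎_)
open import Relation.Nullary using (¬_)
open import Relation.Binary.PropositionalEquality using (_≡_; _≢_)

record Graph (n : ℕ) : Set where
  field
    adj   : Fin n → Fin n → Bool
    sym   : ∀ x y → adj x y ≡ adj y x
    irrefl : ∀ x → adj x x ≡ false

open Graph public

module _ {n : ℕ} (G : Graph n) where

  Adj : Fin n → Fin n → Set
  Adj x y = adj G x y ≡ true

  IsIndependent : Subset n → Set
  IsIndependent S = ∀ x y → x ∈ S → y ∈ S → ¬ Adj x y

  IsClique : Subset n → Set
  IsClique S = ∀ x y → x ∈ S → y ∈ S → x ≢ y → Adj x y

  IndependenceNumber : ℕ → Set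
  IndependenceNumber k =
    (Σ (Subset n) λ S → IsIndependent S × ∣ S ∣ ≡ k)
    × (∀ S → IsIndependent S → ∣ S ∣ ≤ k)

  IsDominatingEdge : Fin n → Fin n → Set
  IsDominatingEdge u v =
    Adj u v × (∀ w → w ≢ u → w ≢ v → Adj w u ⊎ Adj w v)

  CommonNbhd : Fin n → Fin n → Subset n
  CommonNbhd u v = tabulate (λ w → adj G u w ∧ adj G v w)

  C5adj : Fin 5 → Fin 5 → Set
  C5adj i j = (toℕ j ≡ (toℕ i + 1) % 5) ⊎ (toℕ i ≡ (toℕ j + 1) % 5)

  InducedIsC5 : Subset n → Set
  InducedIsC5 W = Σ (Fin 5 → Fin n) λ c →
      (∀ i j → c i ≡ c j → i ≡ j)
    × (∀ i → c i ∈ W)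
    × (∀ w → w ∈ W → ∃ λ i → c i ≡ w)
    × (∀ i j → (Adj (c i) (c j) → C5adj i j) × (C5adj i j → Adj (c i) (c j)))

  CoveredByCliques : Subset n → ℕ → Set
  CoveredByCliques W k = Σ ℕ λ ℓ → Σ (Fin ℓ → Subset n) λ C →
      (∀ i → C i ⊆ W)
    × (∀ i → IsClique (C i))
    × (∀ w → w ∈ W → ∃ λ i → w ∈ C i)
    × ℓ ≤ k

{-# OPTIONS --safe #-}
-- By induction on S: a clique is one clique. Otherwise
-- pick a non-edge pq in S. If p has no neighbour in S, then S - p is a clique
-- (a non-edge inside it would form an independent triple with p), so two
-- cliques suffice. If p has a neighbour y, cover the edge py by one clique
-- and S - p - y by induction, unless S - p - y is itself a non-adjacent pair
-- {q, r}; then p ~ r, and S = {p, y, q, r} is covered either by the edges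
-- pr and yq or, if y ≁ q, by the isolated vertex q and the clique {p, y, r}.
module Submission where

open import Defs
open import Data.Bool using (true)
import Data.Bool as Bool
open import Data.Fin using (Fin; zero; suc; _≟_)
open import Data.Fin.Properties using (any?)
open import Data.Fin.Subset using (Subset; _∈_; _⊆_; _⊂_; ∣_∣; ⁅_⁆; _∪_; _─_; _-_)
open import Data.Fin.Subset.Properties
  using (_∈?_; x∈⁅y⁆⇒x≡y; x∈⁅x⁆; x∈p∪q⁺; x∈p∪q⁻; p─q⊆p; x∈p∧x∉q⇒x∈p─q;
         x∈p∧x≢y⇒x∈p-y; p─q─r≡p─q∪r; x∈p⇒p-x⊂p; x∈p⇒∣p-x∣<∣p∣; ⊂-trans)
open import Data.Fin.Subset.Induction using (⊂-wellFounded)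
open import Data.Nat using (ℕ; zero; suc; _+_; _≤_; _<_; z≤n; s≤s; ⌈_/2⌉)
import Data.Nat.Properties as ℕₚ
open import Data.Nat.Properties using (≤-trans; ≤-refl; <⇒≱; ≤∧≢⇒<; ⌈n/2⌉-mono)
open import Data.Product using (∃; ∃₂; _×_; _,_)
import Data.Product as Product
open import Data.Sum using (_⊎_; inj₁; inj₂)
import Data.Sum as Sum
open import Data.Vec.Base using (_∷_; there)
open import Function using (_∘_; id)
open import Induction.WellFounded using (module All)
open import Relation.Nullary using (¬_; Dec; yes; no; contradiction)
open import Relation.Nullary.Decidable using (_×-dec_; ¬?; decidable-stable)
open import Relation.Binary.PropositionalEquality
  using (_≡_; _≢_; refl; trans; subst; ≢-sym) renaming (sym to ≡-sym)

private variable
  n : ℕ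
  p : Subset n

x∈p-y⇒x∈p : ∀ {x y} → x ∈ p - y → x ∈ p
x∈p-y⇒x∈p = p─q⊆p _ _

x∈p-y⇒x≢y : ∀ {x y} → x ∈ p - y → x ≢ y
x∈p-y⇒x≢y {p = p} {y = y} x∈p-y refl = y∉q-y p y x∈p-y
  where
  y∉q-y : ∀ {m} (q : Subset m) y → ¬ y ∈ q - y
  y∉q-y (_ ∷ q) zero    ()
  y∉q-y (_ ∷ q) (suc y) (there y∈q-y) = y∉q-y q y y∈q-y

x∈p⇒x≡y⊎x∈p-y : ∀ {x} y → x ∈ p → x ≡ y ⊎ x ∈ p - y
x∈p⇒x≡y⊎x∈p-y {x = x} y x∈p with x ≟ y
... | yes x≡y = inj₁ x≡y
... | no  x≢y = inj₂ (x∈p∧x≢y⇒x∈p-y x∈p x≢y)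

x∈⁅y⁆∪p⇒x≡y⊎x∈p : ∀ {x y} → x ∈ ⁅ y ⁆ ∪ p → x ≡ y ⊎ x ∈ p
x∈⁅y⁆∪p⇒x≡y⊎x∈p = Sum.map₁ (x∈⁅y⁆⇒x≡y _) ∘ x∈p∪q⁻ _ _

≤∣p-x∣⇒<∣p∣ : ∀ {k x} → x ∈ p → k ≤ ∣ p - x ∣ → k < ∣ p ∣
≤∣p-x∣⇒<∣p∣ x∈p k≤∣p-x∣ = ≤-trans (s≤s k≤∣p-x∣) (x∈p⇒∣p-x∣<∣p∣ x∈p)

2≤∣p∣ : ∀ {a b} → a ∈ p → b ∈ p → a ≢ b → 2 ≤ ∣ p ∣
2≤∣p∣ a∈p b∈p a≢b =
  ≤∣p-x∣⇒<∣p∣ a∈p (≤∣p-x∣⇒<∣p∣ (x∈p∧x≢y⇒x∈p-y b∈p (≢-sym a≢b)) z≤n)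

3≤∣p∣ : ∀ {a b c} → a ∈ p → b ∈ p → c ∈ p → a ≢ b → a ≢ c → b ≢ c → 3 ≤ ∣ p ∣
3≤∣p∣ a∈p b∈p c∈p a≢b a≢c b≢c = ≤∣p-x∣⇒<∣p∣ a∈p
  (2≤∣p∣ (x∈p∧x≢y⇒x∈p-y b∈p (≢-sym a≢b)) (x∈p∧x≢y⇒x∈p-y c∈p (≢-sym a≢c)) b≢c)

∣p∣≤2⇒x≡a⊎x≡b : ∀ {a b} → ∣ p ∣ ≤ 2 → a ∈ p → b ∈ p → a ≢ b →
                 ∀ {x} → x ∈ p → x ≡ a ⊎ x ≡ b
∣p∣≤2⇒x≡a⊎x≡b ∣p∣≤2 a∈p b∈p a≢b {x} x∈p with x ≟ _ | x ≟ _
... | yes x≡a | _       = inj₁ x≡a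
... | no  _   | yes x≡b = inj₂ x≡b
... | no  x≢a | no  x≢b = contradiction ∣p∣≤2
  (<⇒≱ (3≤∣p∣ a∈p b∈p x∈p a≢b (≢-sym x≢a) (≢-sym x≢b)))

module _ {n : ℕ} (G : Graph n) where

  Adj? : ∀ x y → Dec (Adj G x y)
  Adj? x y = adj G x y Bool.≟ true

  Adj-sym : ∀ {x y} → Adj G x y → Adj G y x
  Adj-sym {x} {y} x~y = trans (Graph.sym G y x) x~y

  Adj-irrefl : ∀ {x} → ¬ Adj G x x
  Adj-irrefl {x} x~x with trans (≡-sym x~x) (irrefl G x)
  ... | ()

  HasNonEdge : Subset n → Set
  HasNonEdge S = ∃₂ λ a b → a ∈ S × b ∈ S × a ≢ b × ¬ Adj G a b

  IsClique⊎HasNonEdge : ∀ S → IsClique G S ⊎ HasNonEdge S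
  IsClique⊎HasNonEdge S
    with any? (λ a → any? λ b → a ∈? S ×-dec b ∈? S ×-dec ¬? (a ≟ b) ×-dec ¬? (Adj? a b))
  ... | yes non-edge = inj₂ non-edge
  ... | no  ∄non-edge = inj₁ λ a b a∈S b∈S a≢b →
    decidable-stable (Adj? a b) λ a≁b → ∄non-edge (a , b , a∈S , b∈S , a≢b , a≁b)

  NotNonAdjacentPair : Subset n → Set
  NotNonAdjacentPair S = ∣ S ∣ ≡ 2 → IsClique G S

  NotNonAdjacentPair⊎HasNonEdge : ∀ S → NotNonAdjacentPair S ⊎ (∣ S ∣ ≡ 2 × HasNonEdge S)
  NotNonAdjacentPair⊎HasNonEdge S with IsClique⊎HasNonEdge S | ∣ S ∣ ℕₚ.≟ 2
  ... | inj₁ S-clique   | _          = inj₁ λ _ → S-clique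
  ... | inj₂ _          | no  ∣S∣≢2 = inj₁ λ ∣S∣≡2 → contradiction ∣S∣≡2 ∣S∣≢2
  ... | inj₂ S-non-edge | yes ∣S∣≡2 = inj₂ (∣S∣≡2 , S-non-edge)

  non-edge-partner : ∀ {T q} → ∣ T ∣ ≤ 2 → HasNonEdge T → q ∈ T →
    ∃ λ r → r ∈ T × q ≢ r × ¬ Adj G q r × (∀ {w} → w ∈ T → w ≡ q ⊎ w ≡ r)
  non-edge-partner ∣T∣≤2 (a , b , a∈T , b∈T , a≢b , a≁b) q∈T
    with ∣p∣≤2⇒x≡a⊎x≡b ∣T∣≤2 a∈T b∈T a≢b q∈T
  ... | inj₁ refl = b , b∈T , a≢b , a≁b , ∣p∣≤2⇒x≡a⊎x≡b ∣T∣≤2 a∈T b∈T a≢b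
  ... | inj₂ refl = a , a∈T , ≢-sym a≢b , a≁b ∘ Adj-sym ,
                    Sum.swap ∘ ∣p∣≤2⇒x≡a⊎x≡b ∣T∣≤2 a∈T b∈T a≢b

  IsClique-⁅⁆ : ∀ x → IsClique G ⁅ x ⁆
  IsClique-⁅⁆ x a b a∈⁅x⁆ b∈⁅x⁆ =
    contradiction (trans (x∈⁅y⁆⇒x≡y x a∈⁅x⁆) (≡-sym (x∈⁅y⁆⇒x≡y x b∈⁅x⁆)))

  IsClique-edge : ∀ {K a b} → Adj G a b → (∀ {w} → w ∈ K → w ≡ a ⊎ w ≡ b) → IsClique G K
  IsClique-edge a~b K⊆ab x y x∈K y∈K x≢y with K⊆ab x∈K | K⊆ab y∈K
  ... | inj₁ refl | inj₁ refl = contradiction refl x≢y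
  ... | inj₁ refl | inj₂ refl = a~b
  ... | inj₂ refl | inj₁ refl = Adj-sym a~b
  ... | inj₂ refl | inj₂ refl = contradiction refl x≢y

  IsIndependent-⁅⁆ : ∀ x → IsIndependent G ⁅ x ⁆
  IsIndependent-⁅⁆ x a b a∈⁅x⁆ b∈⁅x⁆
    rewrite x∈⁅y⁆⇒x≡y x a∈⁅x⁆ | x∈⁅y⁆⇒x≡y x b∈⁅x⁆ = Adj-irrefl

  IsIndependent-⁅⁆∪ : ∀ {x K} → IsIndependent G K → (∀ {w} → w ∈ K → ¬ Adj G x w) →
                      IsIndependent G (⁅ x ⁆ ∪ K)
  IsIndependent-⁅⁆∪ K-ind x≁K a b a∈ b∈
    with x∈⁅y⁆∪p⇒x≡y⊎x∈p a∈ | x∈⁅y⁆∪p⇒x≡y⊎x∈p b∈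
  ... | inj₁ refl | inj₁ refl = Adj-irrefl
  ... | inj₁ refl | inj₂ b∈K  = x≁K b∈K
  ... | inj₂ a∈K  | inj₁ refl = x≁K a∈K ∘ Adj-sym
  ... | inj₂ a∈K  | inj₂ b∈K  = K-ind a b a∈K b∈K

  CoveredByCliques-mono : ∀ {S k m} → k ≤ m → CoveredByCliques G S k → CoveredByCliques G S m
  CoveredByCliques-mono k≤m (ℓ , C , C⊆S , C-cliques , covers , ℓ≤k) =
    ℓ , C , C⊆S , C-cliques , covers , ≤-trans ℓ≤k k≤m

  cover₂⇒cover-by-half : ∀ {S} → NotNonAdjacentPair S → HasNonEdge S →
                         CoveredByCliques G S 2 → CoveredByCliques G S ⌈ ∣ S ∣ /2⌉
  cover₂⇒cover-by-half {S} S-good (a , b , a∈S , b∈S , a≢b , a≁b) =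
    CoveredByCliques-mono (⌈n/2⌉-mono 3≤∣S∣)
    where
    3≤∣S∣ : 3 ≤ ∣ S ∣
    3≤∣S∣ = ≤∧≢⇒< (2≤∣p∣ a∈S b∈S a≢b) λ 2≡∣S∣ → a≁b (S-good (≡-sym 2≡∣S∣) a b a∈S b∈S a≢b)

  clique-cover₁ : ∀ {S} → IsClique G S → CoveredByCliques G S 1
  clique-cover₁ {S} S-clique =
    1 , (λ _ → S) , (λ _ w∈S → w∈S) , (λ _ → S-clique) , (λ _ w∈S → zero , w∈S) , ≤-refl

  clique-cover-by-half : ∀ {S} → IsClique G S → CoveredByCliques G S ⌈ ∣ S ∣ /2⌉
  clique-cover-by-half {S} S-clique with ∣ S ∣ in ∣S∣≡
  ... | zero  = 0 , (λ ()) , (λ ()) , (λ ()) ,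
                (λ w w∈S → contradiction (subst (0 <_) ∣S∣≡ (≤∣p-x∣⇒<∣p∣ w∈S z≤n)) λ ()) , z≤n
  ... | suc _ = CoveredByCliques-mono (s≤s z≤n) (clique-cover₁ S-clique)

  add-clique : ∀ {S K k} → K ⊆ S → IsClique G K →
               CoveredByCliques G (S ─ K) k → CoveredByCliques G S (suc k)
  add-clique {S} {K} K⊆S K-clique (ℓ , C , C⊆ , C-cliques , covers , ℓ≤k) =
    suc ℓ , C′ , C′⊆S , C′-cliques , covers′ , s≤s ℓ≤k
    where
    C′ : Fin (suc ℓ) → Subset n
    C′ zero    = K
    C′ (suc i) = C i

    C′⊆S : ∀ i → C′ i ⊆ S
    C′⊆S zero    = K⊆S
    C′⊆S (suc i) = p─q⊆p S K ∘ C⊆ i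

    C′-cliques : ∀ i → IsClique G (C′ i)
    C′-cliques zero    = K-clique
    C′-cliques (suc i) = C-cliques i

    covers′ : ∀ w → w ∈ S → ∃ λ i → w ∈ C′ i
    covers′ w w∈S with w ∈? K
    ... | yes w∈K = zero , w∈K
    ... | no  w∉K = Product.map suc id (covers w (x∈p∧x∉q⇒x∈p─q w∈S w∉K))

  edge-cover : ∀ {S x y k} → x ∈ S → y ∈ S → Adj G x y →
               CoveredByCliques G (S - x - y) k → CoveredByCliques G S (suc k)
  edge-cover {S} {x} {y} x∈S y∈S x~y cover =
    add-clique xy⊆S (IsClique-edge x~y xy⊆xy)
      (subst (λ T → CoveredByCliques G T _) (p─q─r≡p─q∪r S ⁅ x ⁆ ⁅ y ⁆) cover)
    where
    xy⊆xy : ∀ {w} → w ∈ ⁅ x ⁆ ∪ ⁅ y ⁆ → w ≡ x ⊎ w ≡ y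
    xy⊆xy = Sum.map₂ (x∈⁅y⁆⇒x≡y y) ∘ x∈⁅y⁆∪p⇒x≡y⊎x∈p

    xy⊆S : ⁅ x ⁆ ∪ ⁅ y ⁆ ⊆ S
    xy⊆S w∈xy with xy⊆xy w∈xy
    ... | inj₁ refl = x∈S
    ... | inj₂ refl = y∈S

module _ {n : ℕ} (G : Graph n) (α≤2 : ∀ S → IsIndependent G S → ∣ S ∣ ≤ 2) where

  non-edges⇒edge : ∀ {x y z} → x ≢ y → x ≢ z → y ≢ z →
                   ¬ Adj G x y → ¬ Adj G y z → Adj G x z
  non-edges⇒edge {x} {y} {z} x≢y x≢z y≢z x≁y y≁z with Adj? G x z
  ... | yes x~z = x~z
  ... | no  x≁z = contradiction (α≤2 xyz xyz-independent) (<⇒≱ (3≤∣p∣ x∈ y∈ z∈ x≢y x≢z y≢z))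
    where
    xyz : Subset n
    xyz = ⁅ x ⁆ ∪ ⁅ y ⁆ ∪ ⁅ z ⁆

    x∈ : x ∈ xyz
    x∈ = x∈p∪q⁺ (inj₁ (x∈⁅x⁆ x))
    y∈ : y ∈ xyz
    y∈ = x∈p∪q⁺ (inj₂ (x∈p∪q⁺ (inj₁ (x∈⁅x⁆ y))))
    z∈ : z ∈ xyz
    z∈ = x∈p∪q⁺ (inj₂ (x∈p∪q⁺ (inj₂ (x∈⁅x⁆ z))))

    x≁yz : ∀ {w} → w ∈ ⁅ y ⁆ ∪ ⁅ z ⁆ → ¬ Adj G x w
    x≁yz w∈yz with x∈⁅y⁆∪p⇒x≡y⊎x∈p w∈yz
    ... | inj₁ refl = x≁y
    ... | inj₂ w∈⁅z⁆ rewrite x∈⁅y⁆⇒x≡y z w∈⁅z⁆ = x≁z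

    xyz-independent : IsIndependent G xyz
    xyz-independent = IsIndependent-⁅⁆∪ G
      (IsIndependent-⁅⁆∪ G (IsIndependent-⁅⁆ G z)
        (λ w∈⁅z⁆ → subst (¬_ ∘ Adj G y) (≡-sym (x∈⁅y⁆⇒x≡y z w∈⁅z⁆)) y≁z))
      x≁yz

  isolated-vertex-cover : ∀ {S x} → x ∈ S → (∀ {w} → w ∈ S - x → ¬ Adj G x w) →
                          CoveredByCliques G S 2
  isolated-vertex-cover {S} {x} x∈S x-isolated =
    add-clique G (λ w∈⁅x⁆ → subst (_∈ S) (≡-sym (x∈⁅y⁆⇒x≡y x w∈⁅x⁆)) x∈S)
      (IsClique-⁅⁆ G x) (clique-cover₁ G rest-clique)
    where
    rest-clique : IsClique G (S - x)
    rest-clique a b a∈ b∈ a≢b =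
      non-edges⇒edge (x∈p-y⇒x≢y a∈) a≢b (≢-sym (x∈p-y⇒x≢y b∈))
        (x-isolated a∈ ∘ Adj-sym G) (x-isolated b∈)

  four-vertex-cover : ∀ {S p y q} → p ∈ S → y ∈ S - p → Adj G p y →
    q ∈ S → p ≢ q → ¬ Adj G p q → ∣ S - p - y ∣ ≤ 2 → HasNonEdge G (S - p - y) →
    CoveredByCliques G S 2
  four-vertex-cover {S} {p} {y} {q} p∈S y∈S-p p~y q∈S p≢q p≁q ∣T∣≤2 T-non-edge
    with non-edge-partner G ∣T∣≤2 T-non-edge q∈T
    where
    q∈T : q ∈ S - p - y
    q∈T = x∈p∧x≢y⇒x∈p-y (x∈p∧x≢y⇒x∈p-y q∈S (≢-sym p≢q)) λ { refl → p≁q p~y }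
  ... | r , r∈T , q≢r , q≁r , T⊆qr with Adj? G y q
  ... | yes y~q = edge-cover G p∈S r∈S p~r (clique-cover₁ G (IsClique-edge G y~q S-p-r⊆yq))
    where
    r∈S : r ∈ S
    r∈S = x∈p-y⇒x∈p (x∈p-y⇒x∈p r∈T)

    p~r : Adj G p r
    p~r = non-edges⇒edge p≢q (≢-sym (x∈p-y⇒x≢y (x∈p-y⇒x∈p r∈T))) q≢r p≁q q≁r

    S-p-r⊆yq : ∀ {w} → w ∈ S - p - r → w ≡ y ⊎ w ≡ q
    S-p-r⊆yq w∈ with x∈p⇒x≡y⊎x∈p-y y (x∈p-y⇒x∈p w∈)
    ... | inj₁ w≡y = inj₁ w≡y
    ... | inj₂ w∈T with T⊆qr w∈T
    ...   | inj₁ w≡q = inj₂ w≡q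
    ...   | inj₂ w≡r = contradiction w≡r (x∈p-y⇒x≢y w∈)
  ... | no  y≁q = isolated-vertex-cover q∈S q-isolated
    where
    q-isolated : ∀ {w} → w ∈ S - q → ¬ Adj G q w
    q-isolated w∈ with x∈p⇒x≡y⊎x∈p-y p (x∈p-y⇒x∈p w∈)
    ... | inj₁ refl = p≁q ∘ Adj-sym G
    ... | inj₂ w∈S-p with x∈p⇒x≡y⊎x∈p-y y w∈S-p
    ...   | inj₁ refl = y≁q ∘ Adj-sym G
    ...   | inj₂ w∈T with T⊆qr w∈T
    ...     | inj₁ w≡q = contradiction w≡q (x∈p-y⇒x≢y w∈)
    ...     | inj₂ refl = q≁r

  cover-by-half : ∀ S → NotNonAdjacentPair G S → CoveredByCliques G S ⌈ ∣ S ∣ /2⌉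
  cover-by-half = All.wfRec ⊂-wellFounded _ Goal step
    where
    Goal : Subset n → Set
    Goal S = NotNonAdjacentPair G S → CoveredByCliques G S ⌈ ∣ S ∣ /2⌉

    step : ∀ S → (∀ {T} → T ⊂ S → Goal T) → Goal S
    step S rec S-good with IsClique⊎HasNonEdge G S
    ... | inj₁ S-clique = clique-cover-by-half G S-clique
    ... | inj₂ S-non-edge@(p , q , p∈S , q∈S , p≢q , p≁q)
      with any? (λ y → y ∈? S - p ×-dec Adj? G p y)
    ...   | no p-isolated =
            cover₂⇒cover-by-half G S-good S-non-edge
              (isolated-vertex-cover p∈S λ y∈S-p p~y → p-isolated (_ , y∈S-p , p~y))
    ...   | yes (y , y∈S-p , p~y) with NotNonAdjacentPair⊎HasNonEdge G (S - p - y)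
    ...     | inj₁ T-good = CoveredByCliques-mono G (⌈n/2⌉-mono ∣T∣+2≤∣S∣)
                (edge-cover G p∈S (x∈p-y⇒x∈p y∈S-p) p~y (rec T⊂S T-good))
      where
      ∣T∣+2≤∣S∣ : 2 + ∣ S - p - y ∣ ≤ ∣ S ∣
      ∣T∣+2≤∣S∣ = ≤∣p-x∣⇒<∣p∣ p∈S (≤∣p-x∣⇒<∣p∣ y∈S-p ≤-refl)

      T⊂S : S - p - y ⊂ S
      T⊂S = ⊂-trans (x∈p⇒p-x⊂p y∈S-p) (x∈p⇒p-x⊂p p∈S)
    ...     | inj₂ (∣T∣≡2 , T-non-edge) = cover₂⇒cover-by-half G S-good S-non-edge
                (four-vertex-cover p∈S y∈S-p p~y q∈S p≢q p≁q (ℕₚ.≤-reflexive ∣T∣≡2) T-non-edge)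

lemma13 : (n : ℕ) (G : Graph n) (u v : Fin n) →
    IndependenceNumber G 2 →
    IsDominatingEdge G u v →
    4 ≤ ∣ CommonNbhd G u v ∣ →
    ¬ InducedIsC5 G (CommonNbhd G u v) →
    CoveredByCliques G (CommonNbhd G u v) ⌈ ∣ CommonNbhd G u v ∣ /2⌉
lemma13 n G u v (_ , α≤2) _ 4≤∣W∣ _ =
  cover-by-half G α≤2 (CommonNbhd G u v)
    λ ∣W∣≡2 → contradiction (subst (4 ≤_) ∣W∣≡2 4≤∣W∣) λ { (s≤s (s≤s ())) }
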